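{- Let $\mathcal{G}$ be a cofinitary group, $r\in2^\omega$ and $(s,E)\in\mathbb{Z}^\dagger_\mathcal{G}(r)$. Then: (1) if $n\notin\mathrm{dom}(s)$, then for all but finitely many $m<\omega$ we have $(s\cup\{(n,m)\},E)\le(s,E)$ and $(s\cup\{(n,m)\},E)\in\mathbb{Z}^\dagger_\mathcal{G}(r)$; (2) if $m\notin\mathrm{ran}(s)$, then for all but finitely many $n<\omega$ we have $(s\cup\{(n,m)\},E)\le(s,E)$ and $(s\cup\{(n,m)\},E)\in\mathbb{Z}^\dagger_\mathcal{G}(r)$.
   Context: A cofinitary group is a subgroup $\mathcal{G}$ of the group $S_\infty$ of permutations of $\omega$ in which every non-identity element has only finitely many fixed points. Words: $W_\mathcal{G}$ is the set of words in the alphabet $\mathcal{G}\cup\{x,x^{ -1}\}$. For a (partial) injection $s$ and $w\in W_\mathcal{G}$, $w[s]$ is obtained by replacing $x,x^{ -1}$ by $s,s^{ -1}$ and composing (rightmost letter first); $\mathrm{fix}(w[s])=\{n: w[s](n)\text{ defined and }=n\}$. A word is nice if it is $x^k$ ($k>0$) or $g_lx^{k_l}\cdots g_1x^{k_1}g_0x^{k_0}$ with $k_0>0$, $k_i\in\mathbb{Z}\setminus\{0\}$, $g_i\in\mathcal{G}\setminus\{\mathrm{id}\}$; $W^*_\mathcal{G}$ is the set of nice words. A nice word $w$ is indecomposable if there are no $v\in W^*_\mathcal{G}$, $k>1$ with $v^k=w$; $W^\dagger_\mathcal{G}$ is the set of indecomposable nice words. $\mathbb{Z}_\mathcal{G}$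 consists of pairs $(s,E)$, $s$ a finite partial injection $\omega\to\omega$, $E$ a finite subset of $W^*_\mathcal{G}$, with $(t,F)\le(s,E)$ iff $s\subseteq t$, $E\subseteq F$ and $\mathrm{fix}(w[t])=\mathrm{fix}(w[s])$ for all $w\in E$. For a finite partial injection $u$, $O_u(n)$ is the smallest set containing $n$ closed under $u,u^{ -1}$; an orbit $O$ is closed if $O\subseteq\mathrm{dom}(u)\cap\mathrm{ran}(u)$; $\mathcal{O}^c_u$ is the set of closed orbits. With $\langle p_n\rangle$ the increasing enumeration of the primes, $o^\dagger_u(n)=|\{O\in\mathcal{O}^c_u:|O|=p_n\}|\bmod2$, and $u$ codes $r$ up to $n$ if $r\restriction(n+1)=o^\dagger_u\restriction(n+1)$. $\mathbb{Z}^\dagger_\mathcal{G}(r)$ is the set of $(s,E)\in\mathbb{Z}_\mathcal{G}$ such that: $E$ is closed under cyclic permutations and inverses thereof (whenever such a word obtained from a member of $E$ is nice, it belongs to $E$), and for every $w\in E$, if $w=v^k$ with $v\in W^\dagger_\mathcal{G}$ and $k<\omega$, then $v^l\in E$ for all $0<l\le k$, and $v[s]$ codes $r$ up to $n$ for every $n$ with $p_n\le k$. It carries the order of $\mathbb{Z}_\mathcal{G}$. -}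

module Defs where

open import Data.Nat using (ℕ; zero; suc; _≤_; _<_; _≟_)
open import Data.Nat.Primality using (Prime; prime?)
open import Data.Integer using (ℤ; +_; -[1+_])
open import Data.Bool using (Bool; true; false; not; if_then_else_)
open import Data.Maybe using (Maybe; just; nothing; _>>=_)
open import Data.List using (List; []; _∷_; _++_; map; replicate; reverse; length; concatMap; filter; upTo)
open import Data.List.Membership.Propositional using (_∈_; _∉_)
open import Data.List.Relation.Unary.All using (All)
open import Data.List.Relation.Unary.AllPairs using (AllPairs)
open import Data.List.Relation.Unary.Unique.Propositional using (Unique)
open import Data.Product using (Σ; ∃; _×_; _,_; proj₁; proj₂)
open import Data.Sum using (_⊎_)
open import Relation.Nullary using (¬_; does)
open import Relation.Binary.PropositionalEquality using (_≡_; _≢_)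

-- A subgroup G of S_∞ is presented by a type Elt of its elements together
-- with a faithful action  act : Elt → (ℕ → ℕ)  (faithful = two elements
-- inducing the same permutation are equal, so Elt is exactly the set G of
-- permutations), closed under identity, composition and inverses.

record CofinitaryGroup : Set₁ where
  field
    Elt       : Set
    act       : Elt → ℕ → ℕ
    e         : Elt
    _·_       : Elt → Elt → Elt
    inv       : Elt → Elt
    act-e     : ∀ n → act e n ≡ n
    act-·     : ∀ g h n → act (g · h) n ≡ act g (act h n)
    act-inv-l : ∀ g n → act (inv g) (act g n) ≡ n
    act-inv-r : ∀ g n → act g (act (inv g) n) ≡ n
    faithful  : ∀ g h → (∀ n → act g n ≡ act h n) → g ≡ h
    cofinitary : ∀ g → g ≢ e → Σ ℕ λ N → ∀ n → act g n ≡ n → n < N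

-- Finite partial injections ω → ω, as finite lists of pairs (graphs).

PInj : Set
PInj = List (ℕ × ℕ)

dom : PInj → List ℕ
dom s = map proj₁ s

ran : PInj → List ℕ
ran s = map proj₂ s

IsPInj : PInj → Set
IsPInj s = Unique (dom s) × Unique (ran s)

_⊆ₚ_ : PInj → PInj → Set
s ⊆ₚ t = ∀ {p} → p ∈ s → p ∈ t

appF : PInj → ℕ → Maybe ℕ
appF [] n = nothing
appF ((a , b) ∷ s) n = if does (a ≟ n) then just b else appF s n

appB : PInj → ℕ → Maybe ℕ
appB [] n = nothing
appB ((a , b) ∷ s) n = if does (b ≟ n) then just a else appB s n

PFun : Set
PFun = ℕ → Maybe ℕ

-- m ∈ O_u(n): the smallest set containing n closed under u and u⁻¹
data Reach (u : PFun) (n : ℕ) : ℕ → Set where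
  here : Reach u n n
  fwd  : ∀ {m m'} → Reach u n m → u m ≡ just m' → Reach u n m'
  bwd  : ∀ {m m'} → Reach u n m → u m' ≡ just m → Reach u n m'

ClosedOrbit : PFun → ℕ → Set
ClosedOrbit u n = ∀ m → Reach u n m →
  (Σ ℕ λ m' → u m ≡ just m') × (Σ ℕ λ m' → u m' ≡ just m)

OrbitSize : PFun → ℕ → ℕ → Set
OrbitSize u n q = Σ (List ℕ) λ L → Unique L × length L ≡ q ×
  (∀ m → (m ∈ L → Reach u n m) × (Reach u n m → m ∈ L))

-- there are exactly c closed orbits of u of size q
-- (witnessed by a list of c representatives of pairwise distinct orbits,
--  such that every closed orbit of size q contains one of them)
NumClosedOrbits : PFun → ℕ → ℕ → Set
NumClosedOrbits u q c = Σ (List ℕ) λ reps → length reps ≡ c ×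
  All (λ a → ClosedOrbit u a × OrbitSize u a q) reps ×
  AllPairs (λ a b → ¬ Reach u a b) reps ×
  (∀ n → ClosedOrbit u n → OrbitSize u n q → Σ ℕ λ a → a ∈ reps × Reach u a n)

parity : ℕ → Bool
parity zero = false
parity (suc n) = not (parity n)

-- q = p_j, the j-th prime (p_0 = 2): q is prime and exactly j primes are < q
IsNthPrime : ℕ → ℕ → Set
IsNthPrime j q = Prime q × length (filter prime? (upTo q)) ≡ j

-- o†_u(j) = (number of closed orbits of size p_j) mod 2
ODagger : PFun → ℕ → Bool → Set
ODagger u j b = ∀ q → IsNthPrime j q → Σ ℕ λ c → NumClosedOrbits u q c × parity c ≡ b

Codes : (ℕ → Bool) → PFun → ℕ → Set
Codes r u n = ∀ j → j ≤ n → ODagger u j (r j)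

module _ (G : CofinitaryGroup) where
  open CofinitaryGroup G

  data Letter : Set where
    gl   : Elt → Letter
    X    : Letter
    Xinv : Letter

  -- written left to right; the rightmost letter acts first
  Word : Set
  Word = List Letter

  applyLetter : PInj → Letter → ℕ → Maybe ℕ
  applyLetter s (gl g) n = just (act g n)
  applyLetter s X n = appF s n
  applyLetter s Xinv n = appB s n

  eval : Word → PInj → PFun
  eval [] s n = just n
  eval (a ∷ w) s n = eval w s n >>= applyLetter s a

  xpow : ℤ → Word
  xpow (+ k) = replicate k X
  xpow -[1+ k ] = replicate (suc k) Xinv

  block : Elt × ℤ → Word
  block (g , k) = gl g ∷ xpow k

  -- nice words:  x^k (k>0)  or  g_l x^{k_l} ⋯ g_1 x^{k_1} g_0 x^{k_0}
  -- (the list L is [(g_l,k_l), …, (g_1,k_1)], possibly empty)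
  Nice : Word → Set
  Nice w = (Σ ℕ λ k → 0 < k × w ≡ replicate k X)
         ⊎ (Σ (List (Elt × ℤ)) λ L → Σ Elt λ g₀ → Σ ℕ λ k₀ →
             0 < k₀ × g₀ ≢ e ×
             All (λ p → proj₁ p ≢ e × proj₂ p ≢ + 0) L ×
             w ≡ concatMap block L ++ (gl g₀ ∷ replicate k₀ X))

  wpow : Word → ℕ → Word
  wpow v zero = []
  wpow v (suc k) = v ++ wpow v k

  Indecomposable : Word → Set
  Indecomposable w = Nice w × ¬ (Σ Word λ v → Σ ℕ λ k → Nice v × 1 < k × wpow v k ≡ w)

  invLetter : Letter → Letter
  invLetter (gl g) = gl (inv g)
  invLetter X = Xinv
  invLetter Xinv = X

  winv : Word → Word
  winv w = reverse (map invLetter w)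

  Cond : Set
  Cond = PInj × List Word

  InZ : Cond → Set
  InZ (s , E) = IsPInj s × All Nice E

  FixEq : Word → PInj → PInj → Set
  FixEq w t s = ∀ n → (eval w t n ≡ just n → eval w s n ≡ just n)
                    × (eval w s n ≡ just n → eval w t n ≡ just n)

  _≤Z_ : Cond → Cond → Set
  (t , F) ≤Z (s , E) = s ⊆ₚ t × (∀ {w} → w ∈ E → w ∈ F) × (∀ {w} → w ∈ E → FixEq w t s)

  CyclicClosed : List Word → Set
  CyclicClosed E = ∀ {w} → w ∈ E → ∀ u v → w ≡ u ++ v →
    (Nice (v ++ u) → (v ++ u) ∈ E) × (Nice (winv (v ++ u)) → winv (v ++ u) ∈ E)

  PowerCond : (ℕ → Bool) → PInj → List Word → Set
  PowerCond r s E = ∀ {w} → w ∈ E → ∀ v k → Indecomposable v → w ≡ wpow v k →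
    (∀ l → 0 < l → l ≤ k → wpow v l ∈ E) ×
    (∀ n q → IsNthPrime n q → q ≤ k → Codes r (eval v s) n)

  InZDagger : (ℕ → Bool) → Cond → Set
  InZDagger r (s , E) = InZ (s , E) × CyclicClosed E × PowerCond r s E

-- Adding a pair (n , m) to s changes w[s] only at the two ends of its chains as long as the new
-- point is generic for the group letters occurring in E: each such g moves it, and neither g nor g⁻¹
-- sends it into the support of s.  Then fixed points of the words of E and closed orbits of their
-- indecomposable roots are unchanged, so (s ∪ {(n , m)}, E) extends (s , E) and still codes r.
-- Being cofinitary, each g fixes only finitely many points, so all but finitely many points are generic.
module Submission where

open import Defs
open import Data.Nat using (ℕ; zero; suc; _≤_; _⊔_; _≟_)
open import Data.Nat.Properties using (≤-trans; m≤m⊔n; m≤n⊔m; <-irrefl; ≤⇒≯)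
open import Data.Bool using (Bool; if_then_else_)
open import Data.Maybe using (Maybe; just; _>>=_)
open import Data.Maybe.Properties using (just-injective)
open import Data.List using (List; []; _∷_; _++_; map; replicate; concatMap)
open import Data.List.Properties using (++-assoc)
open import Data.List.Membership.Propositional using (_∈_; _∉_)
open import Data.List.Membership.Propositional.Properties using (∈-map⁺; ∈-++⁺ˡ; ∈-++⁺ʳ)
open import Data.List.Relation.Unary.Any using (here; there)
open import Data.List.Relation.Unary.All as All using (All; []; _∷_)
open import Data.List.Relation.Unary.All.Properties using (¬Any⇒All¬)
open import Data.List.Relation.Unary.AllPairs using (AllPairs; []; _∷_)
open import Data.List.Relation.Unary.Unique.Propositional using (Unique)
open import Data.Integer using (+_; -[1+_])
open import Data.Product using (Σ; _×_; _,_; proj₁; proj₂)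
open import Data.Sum using (_⊎_; inj₁; inj₂)
open import Data.Unit using (⊤; tt)
open import Data.Empty using (⊥; ⊥-elim)
open import Function using (id; _∘_)
open import Relation.Nullary using (¬_; Dec; yes; no; does)
open import Relation.Binary.PropositionalEquality using (_≡_; _≢_; refl; sym; trans; cong; subst)

Eventually : (ℕ → Set) → Set
Eventually P = Σ ℕ λ M → ∀ m → M ≤ m → P m

eventually-map : ∀ {P Q : ℕ → Set} → (∀ {m} → P m → Q m) → Eventually P → Eventually Q
eventually-map f (M , p) = M , λ m M≤m → f (p m M≤m)

eventually-× : ∀ {P Q : ℕ → Set} → Eventually P → Eventually Q → Eventually (λ m → P m × Q m)
eventually-× (M , p) (N , q) =
  M ⊔ N , λ m M⊔N≤m → p m (≤-trans (m≤m⊔n M N) M⊔N≤m) , q m (≤-trans (m≤n⊔m M N) M⊔N≤m)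

eventually-∀∈ : ∀ {A : Set} {P : A → ℕ → Set} (xs : List A) →
  (∀ {x} → x ∈ xs → Eventually (P x)) → Eventually (λ m → ∀ {x} → x ∈ xs → P x m)
eventually-∀∈ [] _ = 0 , λ _ _ ()
eventually-∀∈ {P = P} (x ∷ xs) ev = eventually-map ∀∈-∷ (eventually-× (ev (here refl)) (eventually-∀∈ xs (ev ∘ there)))
  where
  ∀∈-∷ : ∀ {m} → P x m × (∀ {y} → y ∈ xs → P y m) → ∀ {y} → y ∈ x ∷ xs → P y m
  ∀∈-∷ (p , _) (here refl) = p
  ∀∈-∷ (_ , ps) (there i) = ps i

eventually-≢ : ∀ k → Eventually (_≢ k)
eventually-≢ k = suc k , λ m k<m m≡k → <-irrefl (sym m≡k) k<m

eventually-∉ : ∀ xs → Eventually (_∉ xs)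
eventually-∉ xs = eventually-map (λ ≢xs m∈xs → ≢xs m∈xs refl) (eventually-∀∈ xs (λ {k} _ → eventually-≢ k))

eventually-image-∉ : ∀ (f f⁻¹ : ℕ → ℕ) → (∀ x → f⁻¹ (f x) ≡ x) → ∀ xs → Eventually (λ x → f x ∉ xs)
eventually-image-∉ f f⁻¹ f⁻¹∘f xs = eventually-map image-∉ (eventually-∉ (map f⁻¹ xs))
  where
  image-∉ : ∀ {x} → x ∉ map f⁻¹ xs → f x ∉ xs
  image-∉ {x} x∉ fx∈ = x∉ (subst (_∈ map f⁻¹ xs) (f⁻¹∘f x) (∈-map⁺ f⁻¹ fx∈))

bind-just : ∀ {mx : Maybe ℕ} {f : ℕ → Maybe ℕ} {y b} → mx ≡ just y → f y ≡ just b → (mx >>= f) ≡ just b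
bind-just refl fy≡b = fy≡b

bind-just⁻¹ : ∀ {mx : Maybe ℕ} {f : ℕ → Maybe ℕ} {b} → (mx >>= f) ≡ just b →
  Σ ℕ λ y → mx ≡ just y × f y ≡ just b
bind-just⁻¹ {just y} eq = y , refl , eq

unique-map-injective : ∀ {A B : Set} (f : A → B) {xs x y} →
  Unique (map f xs) → x ∈ xs → y ∈ xs → f x ≡ f y → x ≡ y
unique-map-injective f _ (here refl) (here refl) _ = refl
unique-map-injective f (fx∉ ∷ _) (here refl) (there j) eq = ⊥-elim (All.lookup fx∉ (∈-map⁺ f j) eq)
unique-map-injective f (fy∉ ∷ _) (there i) (here refl) eq = ⊥-elim (All.lookup fy∉ (∈-map⁺ f i) (sym eq))
unique-map-injective f (_ ∷ u) (there i) (there j) eq = unique-map-injective f u i j eq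

support : PInj → List ℕ
support s = dom s ++ ran s

dom⊆support : ∀ {s y} → y ∈ dom s → y ∈ support s
dom⊆support = ∈-++⁺ˡ

ran⊆support : ∀ {s y} → y ∈ ran s → y ∈ support s
ran⊆support {s} = ∈-++⁺ʳ (dom s)

∷-dom⊆∷-support : ∀ {s p y} → y ∈ p ∷ dom s → y ∈ p ∷ support s
∷-dom⊆∷-support = ∈-++⁺ˡ

∷-ran⊆∷-support : ∀ {s p y} → y ∈ p ∷ ran s → y ∈ p ∷ support s
∷-ran⊆∷-support (here y≡p) = here y≡p
∷-ran⊆∷-support (there i) = there (ran⊆support i)

isPInj-∷ : ∀ {s n m} → IsPInj s → n ∉ dom s → m ∉ ran s → IsPInj ((n , m) ∷ s)
isPInj-∷ (unique-dom , unique-ran) n∉dom m∉ran =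
  ¬Any⇒All¬ _ n∉dom ∷ unique-dom , ¬Any⇒All¬ _ m∉ran ∷ unique-ran

appF-∷⁻¹ : ∀ {a b t x y} → appF ((a , b) ∷ t) x ≡ just y → (a ≡ x × b ≡ y) ⊎ appF t x ≡ just y
appF-∷⁻¹ {a} {b} {t} {x} {y} = split (a ≟ x)
  where
  split : (d : Dec (a ≡ x)) → (if does d then just b else appF t x) ≡ just y → (a ≡ x × b ≡ y) ⊎ appF t x ≡ just y
  split (yes a≡x) eq = inj₁ (a≡x , just-injective eq)
  split (no _) eq = inj₂ eq

appB-∷⁻¹ : ∀ {a b t x y} → appB ((a , b) ∷ t) x ≡ just y → (b ≡ x × a ≡ y) ⊎ appB t x ≡ just y
appB-∷⁻¹ {a} {b} {t} {x} {y} = split (b ≟ x)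
  where
  split : (d : Dec (b ≡ x)) → (if does d then just a else appB t x) ≡ just y → (b ≡ x × a ≡ y) ⊎ appB t x ≡ just y
  split (yes b≡x) eq = inj₁ (b≡x , just-injective eq)
  split (no _) eq = inj₂ eq

appF⇒∈ : ∀ t {x y} → appF t x ≡ just y → (x , y) ∈ t
appF⇒∈ ((a , b) ∷ t) eq with appF-∷⁻¹ {a} {b} {t} eq
... | inj₁ (refl , refl) = here refl
... | inj₂ eq′ = there (appF⇒∈ t eq′)

appB⇒∈ : ∀ t {x y} → appB t x ≡ just y → (y , x) ∈ t
appB⇒∈ ((a , b) ∷ t) eq with appB-∷⁻¹ {a} {b} {t} eq
... | inj₁ (refl , refl) = here refl
... | inj₂ eq′ = there (appB⇒∈ t eq′)

appF⇒∈dom : ∀ {t x y} → appF t x ≡ just y → x ∈ dom t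
appF⇒∈dom {t} = ∈-map⁺ proj₁ ∘ appF⇒∈ t

appF⇒∈ran : ∀ {t x y} → appF t x ≡ just y → y ∈ ran t
appF⇒∈ran {t} = ∈-map⁺ proj₂ ∘ appF⇒∈ t

appB⇒∈ran : ∀ {t x y} → appB t x ≡ just y → x ∈ ran t
appB⇒∈ran {t} = ∈-map⁺ proj₂ ∘ appB⇒∈ t

appB⇒∈dom : ∀ {t x y} → appB t x ≡ just y → y ∈ dom t
appB⇒∈dom {t} = ∈-map⁺ proj₁ ∘ appB⇒∈ t

appF-∷⁺ : ∀ {a b t x y} → a ∉ dom t → appF t x ≡ just y → appF ((a , b) ∷ t) x ≡ just y
appF-∷⁺ {a} {b} {t} {x} {y} a∉dom eq = keep (a ≟ x)
  where
  keep : (d : Dec (a ≡ x)) → (if does d then just b else appF t x) ≡ just y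
  keep (yes refl) = ⊥-elim (a∉dom (appF⇒∈dom eq))
  keep (no _) = eq

appB-∷⁺ : ∀ {a b t x y} → b ∉ ran t → appB t x ≡ just y → appB ((a , b) ∷ t) x ≡ just y
appB-∷⁺ {a} {b} {t} {x} {y} b∉ran eq = keep (b ≟ x)
  where
  keep : (d : Dec (b ≡ x)) → (if does d then just a else appB t x) ≡ just y
  keep (yes refl) = ⊥-elim (b∉ran (appB⇒∈ran eq))
  keep (no _) = eq

appF-injective : ∀ {t x x′ y} → Unique (ran t) → appF t x ≡ just y → appF t x′ ≡ just y → x ≡ x′
appF-injective {t} unique eq eq′ =
  cong proj₁ (unique-map-injective proj₂ unique (appF⇒∈ t eq) (appF⇒∈ t eq′) refl)

appB-injective : ∀ {t x x′ y} → Unique (dom t) → appB t x ≡ just y → appB t x′ ≡ just y → x ≡ x′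
appB-injective {t} unique eq eq′ =
  cong proj₂ (unique-map-injective proj₁ unique (appB⇒∈ t eq) (appB⇒∈ t eq′) refl)

InDom : PFun → ℕ → Set
InDom u x = Σ ℕ λ y → u x ≡ just y

InRan : PFun → ℕ → Set
InRan u y = Σ ℕ λ x → u x ≡ just y

-- Every edge x ↦ y of u′ that is neither the first nor the last edge of its chain is an edge of u.
InnerEdgesAgree : PFun → PFun → Set
InnerEdgesAgree u u′ = ∀ {x y} → u′ x ≡ just y → InDom u′ y → InRan u′ x → u x ≡ just y

record EndExtension (u u′ : PFun) : Set where
  field
    extends   : ∀ {x y} → u x ≡ just y → u′ x ≡ just y
    injective : ∀ {x x′ y} → u′ x ≡ just y → u′ x′ ≡ just y → x ≡ x′
    inner     : InnerEdgesAgree u u′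

module _ {u u′ : PFun} (ext : EndExtension u u′) where
  open EndExtension ext

  fixedPoint⁻ : ∀ {x} → u′ x ≡ just x → u x ≡ just x
  fixedPoint⁻ {x} fx = inner fx (x , fx) (x , fx)

  reach⁺ : ∀ {a b} → Reach u a b → Reach u′ a b
  reach⁺ here = here
  reach⁺ (fwd r e) = fwd (reach⁺ r) (extends e)
  reach⁺ (bwd r e) = bwd (reach⁺ r) (extends e)

  forward-edge⁻ : ∀ {a b c} → ClosedOrbit u a → Reach u a b → u′ b ≡ just c → u b ≡ just c
  forward-edge⁻ cl r e with proj₁ (cl _ r)
  ... | _ , e⁻ with trans (sym (extends e⁻)) e
  ...   | refl = e⁻

  backward-edge⁻ : ∀ {a b c} → ClosedOrbit u a → Reach u a b → u′ c ≡ just b → u c ≡ just b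
  backward-edge⁻ cl r e with proj₂ (cl _ r)
  ... | _ , e⁻ with injective (extends e⁻) e
  ...   | refl = e⁻

  reach⁻ : ∀ {a b} → ClosedOrbit u a → Reach u′ a b → Reach u a b
  reach⁻ cl here = here
  reach⁻ cl (fwd r e) = fwd (reach⁻ cl r) (forward-edge⁻ cl (reach⁻ cl r) e)
  reach⁻ cl (bwd r e) = bwd (reach⁻ cl r) (backward-edge⁻ cl (reach⁻ cl r) e)

  closedOrbit⁺ : ∀ {a} → ClosedOrbit u a → ClosedOrbit u′ a
  closedOrbit⁺ cl b r with cl b (reach⁻ cl r)
  ... | (y , e) , (z , e′) = (y , extends e) , (z , extends e′)

  closedOrbit⁻ : ∀ {a} → ClosedOrbit u′ a → ClosedOrbit u a
  closedOrbit⁻ cl x r with cl x (reach⁺ r)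
  ... | (y , e) , (z , e′) =
    (y , inner e (proj₁ (cl y (fwd (reach⁺ r) e))) (z , e′)) ,
    (z , inner e′ (y , e) (proj₂ (cl z (bwd (reach⁺ r) e′))))

  orbitSize⁺ : ∀ {a q} → ClosedOrbit u a → OrbitSize u a q → OrbitSize u′ a q
  orbitSize⁺ cl (L , unique , length≡ , members) =
    L , unique , length≡ , λ b → reach⁺ ∘ proj₁ (members b) , proj₂ (members b) ∘ reach⁻ cl

  orbitSize⁻ : ∀ {a q} → ClosedOrbit u a → OrbitSize u′ a q → OrbitSize u a q
  orbitSize⁻ cl (L , unique , length≡ , members) =
    L , unique , length≡ , λ b → reach⁻ cl ∘ proj₁ (members b) , proj₂ (members b) ∘ reach⁺

  disjointOrbits⁺ : ∀ {reps} → All (ClosedOrbit u) reps →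
    AllPairs (λ a b → ¬ Reach u a b) reps → AllPairs (λ a b → ¬ Reach u′ a b) reps
  disjointOrbits⁺ [] [] = []
  disjointOrbits⁺ (cl ∷ cls) (apart ∷ apart*) =
    All.map (λ ¬r → ¬r ∘ reach⁻ cl) apart ∷ disjointOrbits⁺ cls apart*

  numClosedOrbits⁺ : ∀ {q c} → NumClosedOrbits u q c → NumClosedOrbits u′ q c
  numClosedOrbits⁺ {q} (reps , length≡ , orbits , disjoint , complete) =
    reps , length≡ ,
    All.map (λ (cl , size) → closedOrbit⁺ cl , orbitSize⁺ cl size) orbits ,
    disjointOrbits⁺ (All.map proj₁ orbits) disjoint ,
    complete′
    where
    complete′ : ∀ b → ClosedOrbit u′ b → OrbitSize u′ b q → Σ ℕ λ a → a ∈ reps × Reach u′ a b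
    complete′ b cl size with complete b (closedOrbit⁻ cl) (orbitSize⁻ (closedOrbit⁻ cl) size)
    ... | a , a∈reps , r = a , a∈reps , reach⁺ r

  codes⁺ : ∀ {r j} → Codes r u j → Codes r u′ j
  codes⁺ codes i i≤j q q-prime with codes i i≤j q q-prime
  ... | c , num , parity≡ = c , numClosedOrbits⁺ num , parity≡

module Words (G : CofinitaryGroup) where
  open CofinitaryGroup G

  act≡⇒≡act-inv : ∀ g {y z} → act g y ≡ z → y ≡ act (inv g) z
  act≡⇒≡act-inv g {y} eq = trans (sym (act-inv-l g y)) (cong (act (inv g)) eq)

  act-injective : ∀ g {x x′} → act g x ≡ act g x′ → x ≡ x′
  act-injective g {x′ = x′} eq = trans (act≡⇒≡act-inv g eq) (act-inv-l g x′)

  CanPrecede : Letter G → Letter G → Set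
  CanPrecede (gl _) (gl _) = ⊥
  CanPrecede X Xinv = ⊥
  CanPrecede Xinv X = ⊥
  CanPrecede _ _ = ⊤

  NonTrivial : Letter G → Set
  NonTrivial (gl g) = g ≢ e
  NonTrivial _ = ⊤

  -- The base case is the rightmost letter, which acts first: a nice word ends in x^k₀ with k₀ > 0.
  data Reduced : Word G → Set where
    [X]  : Reduced (X ∷ [])
    cons : ∀ {c d w} → CanPrecede c d → NonTrivial c → Reduced (d ∷ w) → Reduced (c ∷ d ∷ w)

  HeadIsXinv : Word G → Set
  HeadIsXinv (Xinv ∷ _) = ⊤
  HeadIsXinv _ = ⊥

  reduced⇒nonTrivial : ∀ {w} → Reduced w → All NonTrivial w
  reduced⇒nonTrivial [X] = tt ∷ []
  reduced⇒nonTrivial (cons _ nt r) = nt ∷ reduced⇒nonTrivial r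

  reduced-replicate-X : ∀ k → Reduced (replicate (suc k) X)
  reduced-replicate-X zero = [X]
  reduced-replicate-X (suc k) = cons tt tt (reduced-replicate-X k)

  reduced-replicate-++ : ∀ {c d w} → CanPrecede c c → CanPrecede c d → NonTrivial c →
    Reduced (d ∷ w) → ∀ k → Reduced (replicate (suc k) c ++ d ∷ w)
  reduced-replicate-++ cc cd nt r zero = cons cd nt r
  reduced-replicate-++ cc cd nt r (suc k) = cons cc nt (reduced-replicate-++ cc cd nt r k)

  reduced-block : ∀ {g h w} k → g ≢ e → k ≢ + 0 → Reduced (gl h ∷ w) → Reduced (gl g ∷ xpow G k ++ gl h ∷ w)
  reduced-block (+ zero) _ k≢0 _ = ⊥-elim (k≢0 refl)
  reduced-block (+ suc j) g≢e _ r = cons tt g≢e (reduced-replicate-++ {c = X} tt tt tt r j)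
  reduced-block -[1+ j ] g≢e _ r = cons tt g≢e (reduced-replicate-++ {c = Xinv} tt tt tt r j)

  reduced-blocks : ∀ L → All (λ p → proj₁ p ≢ e × proj₂ p ≢ + 0) L → ∀ {h w} → Reduced (gl h ∷ w) →
    Σ Elt λ h′ → Σ (Word G) λ w′ → concatMap (block G) L ++ gl h ∷ w ≡ gl h′ ∷ w′ × Reduced (gl h′ ∷ w′)
  reduced-blocks [] [] {h} {w} r = h , w , refl , r
  reduced-blocks ((g , k) ∷ L) ((g≢e , k≢0) ∷ ok) {h} {w} r with reduced-blocks L ok r
  ... | h′ , w′ , eq , r′ = g , xpow G k ++ gl h′ ∷ w′ , cong (gl g ∷_) reassoc , reduced-block k g≢e k≢0 r′
    where
    reassoc : (xpow G k ++ concatMap (block G) L) ++ gl h ∷ w ≡ xpow G k ++ gl h′ ∷ w′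
    reassoc = trans (++-assoc (xpow G k) _ _) (cong (xpow G k ++_) eq)

  nice⇒reduced : ∀ {w} → Nice G w → Reduced w × ¬ HeadIsXinv w
  nice⇒reduced (inj₁ (suc k , _ , refl)) = reduced-replicate-X k , id
  nice⇒reduced (inj₂ (L , g₀ , suc k₀ , _ , g₀≢e , ok , refl))
    with reduced-blocks L ok (cons tt g₀≢e (reduced-replicate-X k₀))
  ... | _ , _ , eq , r = subst Reduced (sym eq) r , subst HeadIsXinv eq

  letter-of-root : ∀ {w v c} k → Nice G w → w ≡ wpow G v k → c ∈ v → c ∈ w
  letter-of-root zero nice refl _ with proj₁ (nice⇒reduced nice)
  ... | ()
  letter-of-root (suc k) _ refl c∈v = ∈-++⁺ˡ c∈v

  applyLetter-injective : ∀ {t} → IsPInj t → ∀ c {x x′ y} →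
    applyLetter G t c x ≡ just y → applyLetter G t c x′ ≡ just y → x ≡ x′
  applyLetter-injective _ (gl g) eq eq′ = act-injective g (just-injective (trans eq (sym eq′)))
  applyLetter-injective (_ , unique-ran) X eq eq′ = appF-injective unique-ran eq eq′
  applyLetter-injective (unique-dom , _) Xinv eq eq′ = appB-injective unique-dom eq eq′

  eval-injective : ∀ {t} → IsPInj t → ∀ w {a a′ b} → eval G w t a ≡ just b → eval G w t a′ ≡ just b → a ≡ a′
  eval-injective _ [] eq eq′ = just-injective (trans eq (sym eq′))
  eval-injective {t} p (c ∷ w) eq eq′
    with bind-just⁻¹ {eval G w t _} eq | bind-just⁻¹ {eval G w t _} eq′
  ... | _ , e , f | _ , e′ , f′ with applyLetter-injective p c f f′
  ...   | refl = eval-injective p w e e′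

  eval-extends : ∀ {s n m} → n ∉ dom s → m ∉ ran s →
    ∀ w {a b} → eval G w s a ≡ just b → eval G w ((n , m) ∷ s) a ≡ just b
  eval-extends _ _ [] eq = eq
  eval-extends {s} {n} {m} n∉dom m∉ran (c ∷ w) eq with bind-just⁻¹ {eval G w s _} eq
  ... | _ , e , f = bind-just (eval-extends n∉dom m∉ran w e) (letter c f)
    where
    letter : ∀ c {x y} → applyLetter G s c x ≡ just y → applyLetter G ((n , m) ∷ s) c x ≡ just y
    letter (gl g) = id
    letter X = appF-∷⁺ n∉dom
    letter Xinv = appB-∷⁺ m∉ran

  reduced⇒∈dom : ∀ {t w a b} → Reduced w → eval G w t a ≡ just b → a ∈ dom t
  reduced⇒∈dom [X] eq = appF⇒∈dom eq
  reduced⇒∈dom {t} (cons {d = d} {w} _ _ r) eq with bind-just⁻¹ {eval G (d ∷ w) t _} eq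
  ... | _ , e , _ = reduced⇒∈dom r e

  record Generic (F : List ℕ) (x : ℕ) (g : Elt) : Set where
    field
      moved          : act g x ≢ x
      image-fresh    : act g x ∉ F
      preimage-fresh : act (inv g) x ∉ F
  open Generic

  GenericLetter : List ℕ → ℕ → Letter G → Set
  GenericLetter F x (gl g) = Generic F x g
  GenericLetter F x _ = ⊤

  eventually-generic : ∀ F {g} → g ≢ e → Eventually (λ x → Generic F x g)
  eventually-generic F {g} g≢e =
    eventually-map (λ (mv , im , pre) → record { moved = mv ; image-fresh = im ; preimage-fresh = pre })
      (eventually-× eventually-moved
        (eventually-× (eventually-image-∉ (act g) (act (inv g)) (act-inv-l g) F)
                      (eventually-image-∉ (act (inv g)) (act g) (act-inv-r g) F)))
    where
    eventually-moved : Eventually (λ x → act g x ≢ x)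
    eventually-moved with cofinitary g g≢e
    ... | N , fixed<N = N , λ x N≤x gx≡x → ≤⇒≯ N≤x (fixed<N x gx≡x)

  eventually-genericLetters : ∀ F (E : List (Word G)) → All (Nice G) E →
    Eventually (λ x → ∀ {w} → w ∈ E → ∀ {c} → c ∈ w → GenericLetter F x c)
  eventually-genericLetters F E niceE =
    eventually-∀∈ {P = λ w x → ∀ {c} → c ∈ w → GenericLetter F x c} E λ {w} w∈E →
      eventually-∀∈ w λ c∈w → letter (All.lookup (reduced⇒nonTrivial (proj₁ (nice⇒reduced (All.lookup niceE w∈E)))) c∈w)
    where
    letter : ∀ {c} → NonTrivial c → Eventually (λ x → GenericLetter F x c)
    letter {gl g} g≢e = eventually-generic F g≢e
    letter {X} _ = 0 , λ _ _ → tt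
    letter {Xinv} _ = 0 , λ _ _ → tt

  module _ {F x g} (gen : Generic F x g) where
    act≢-on : ∀ {y} → y ∈ F → act g y ≢ x
    act≢-on y∈F gy≡x = preimage-fresh gen (subst (_∈ F) (act≡⇒≡act-inv g gy≡x) y∈F)

    act∉-∷ : ∀ {ys} → (∀ {y} → y ∈ ys → y ∈ F) → act g x ∉ x ∷ ys
    act∉-∷ _ (here gx≡x) = moved gen gx≡x
    act∉-∷ ys⊆F (there i) = image-fresh gen (ys⊆F i)

  module FreshImage (s : PInj) (n m : ℕ) (m-fresh : m ∉ n ∷ support s) where
    private
      s′ : PInj
      s′ = (n , m) ∷ s

    Clean : Letter G → ℕ → Set
    Clean (gl _) b = b ≢ m
    Clean _ b = b ∈ support s

    Tainted : Letter G → ℕ → Set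
    Tainted (gl g) b = b ≡ act g m
    Tainted X b = b ≡ m
    Tainted Xinv _ = ⊥

    -- Evaluating w[s′] from the right, the current value either is the value of w[s], or it was
    -- produced by the new pair n ↦ m, possibly followed by one group letter; such a value has no image.
    Trace : Letter G → Word G → ℕ → ℕ → Set
    Trace c w a b = (eval G (c ∷ w) s a ≡ just b × Clean c b) ⊎ Tainted c b

    GenericWord : Word G → Set
    GenericWord w = ∀ {c} → c ∈ w → GenericLetter (n ∷ support s) m c

    clean-≢ : ∀ c → ¬ Clean c m
    clean-≢ (gl _) m≢m = m≢m refl
    clean-≢ X m∈ = m-fresh (there m∈)
    clean-≢ Xinv m∈ = m-fresh (there m∈)

    clean-act : ∀ {g y} d → Generic (n ∷ support s) m g → CanPrecede (gl g) d → Clean d y → act g y ≢ m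
    clean-act X gen _ y∈ = act≢-on gen (there y∈)
    clean-act Xinv gen _ y∈ = act≢-on gen (there y∈)

    tainted-fresh : ∀ {c w b} → GenericWord (c ∷ w) → Tainted c b → b ∉ n ∷ support s
    tainted-fresh {gl g} gen refl = image-fresh (gen (here refl))
    tainted-fresh {X} _ refl = m-fresh

    step : ∀ c d w {a y b} → CanPrecede c d → GenericWord (c ∷ d ∷ w) →
      Trace d w a y → applyLetter G s′ c y ≡ just b → Trace c (d ∷ w) a b
    step X d w _ _ (inj₁ (ev , _)) eq with appF-∷⁻¹ {n} {m} {s} eq
    ... | inj₁ (refl , refl) = inj₂ refl
    ... | inj₂ eq′ = inj₁ (bind-just ev eq′ , ran⊆support {s} (appF⇒∈ran eq′))
    step X d w _ gen (inj₂ t) eq =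
      ⊥-elim (tainted-fresh (λ i → gen (there i)) t (∷-dom⊆∷-support {s} (appF⇒∈dom {s′} eq)))
    step Xinv d w _ _ (inj₁ (ev , cl)) eq with appB-∷⁻¹ {n} {m} {s} eq
    ... | inj₁ (refl , _) = ⊥-elim (clean-≢ d cl)
    ... | inj₂ eq′ = inj₁ (bind-just ev eq′ , dom⊆support {s} (appB⇒∈dom eq′))
    step Xinv Xinv w _ _ (inj₂ ()) _
    step Xinv (gl g) w _ gen (inj₂ refl) eq =
      ⊥-elim (act∉-∷ (gen (there (here refl))) (λ i → there (ran⊆support i)) (appB⇒∈ran {s′} eq))
    step (gl g) d w adj gen (inj₁ (ev , cl)) eq =
      inj₁ (bind-just ev eq , λ b≡m → clean-act d (gen (here refl)) adj cl (trans (just-injective eq) b≡m))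
    step (gl g) X w _ _ (inj₂ refl) eq = inj₂ (sym (just-injective eq))
    step (gl g) Xinv w _ _ (inj₂ ()) _

    trace : ∀ {c w a b} → Reduced (c ∷ w) → GenericWord (c ∷ w) → eval G (c ∷ w) s′ a ≡ just b → Trace c w a b
    trace [X] _ eq with appF-∷⁻¹ {n} {m} {s} eq
    ... | inj₁ (_ , refl) = inj₂ refl
    ... | inj₂ eq′ = inj₁ (eq′ , ran⊆support {s} (appF⇒∈ran eq′))
    trace (cons {c} {d} {w} adj _ r) gen eq with bind-just⁻¹ {eval G (d ∷ w) s′ _} eq
    ... | _ , e , f = step c d w adj gen (trace r (λ i → gen (there i)) e) f

    inner : ∀ {w} → Reduced w → GenericWord w → InnerEdgesAgree (eval G w s) (eval G w s′)
    inner {[]} ()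
    inner {_ ∷ _} r gen eq (_ , eq′) _ with trace r gen eq
    ... | inj₁ (ev , _) = ev
    ... | inj₂ t = ⊥-elim (tainted-fresh gen t (∷-dom⊆∷-support {s} (reduced⇒∈dom r eq′)))

  module FreshPreimage (s : PInj) (n m : ℕ) (n-fresh : n ∉ m ∷ support s) where
    private
      s′ : PInj
      s′ = (n , m) ∷ s

    Clean : Letter G → ℕ → Set
    Clean (gl _) b = b ≢ n
    Clean _ b = b ∈ support s

    Tainted : Letter G → ℕ → Set
    Tainted (gl g) b = b ≡ act g n
    Tainted X _ = ⊥
    Tainted Xinv b = b ≡ n

    -- As for FreshImage with the new pair read backwards; in addition the first letter x may use
    -- the new pair forwards, which only happens at a = n, a point without preimage.
    Trace : Letter G → Word G → ℕ → ℕ → Set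
    Trace c w a b = (eval G (c ∷ w) s a ≡ just b × Clean c b) ⊎ Tainted c b ⊎ a ≡ n

    GenericWord : Word G → Set
    GenericWord w = ∀ {c} → c ∈ w → GenericLetter (m ∷ support s) n c

    clean-≢ : ∀ c → ¬ Clean c n
    clean-≢ (gl _) n≢n = n≢n refl
    clean-≢ X n∈ = n-fresh (there n∈)
    clean-≢ Xinv n∈ = n-fresh (there n∈)

    clean-act : ∀ {g y} d → Generic (m ∷ support s) n g → CanPrecede (gl g) d → Clean d y → act g y ≢ n
    clean-act X gen _ y∈ = act≢-on gen (there y∈)
    clean-act Xinv gen _ y∈ = act≢-on gen (there y∈)

    tainted-fresh : ∀ {c w b} → GenericWord (c ∷ w) → Tainted c b → b ∉ m ∷ support s
    tainted-fresh {gl g} gen refl = image-fresh (gen (here refl))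
    tainted-fresh {Xinv} _ refl = n-fresh

    tainted-∉dom : ∀ {c w b} → ¬ HeadIsXinv (c ∷ w) → GenericWord (c ∷ w) → Tainted c b → b ∉ n ∷ dom s
    tainted-∉dom {gl g} _ gen refl = act∉-∷ (gen (here refl)) (λ i → there (dom⊆support {s} i))
    tainted-∉dom {Xinv} ¬xinv _ _ = ⊥-elim (¬xinv tt)

    step : ∀ c d w {a y b} → CanPrecede c d → GenericWord (c ∷ d ∷ w) →
      Trace d w a y → applyLetter G s′ c y ≡ just b → Trace c (d ∷ w) a b
    step _ _ _ _ _ (inj₂ (inj₂ a≡n)) _ = inj₂ (inj₂ a≡n)
    step X d w _ _ (inj₁ (ev , cl)) eq with appF-∷⁻¹ {n} {m} {s} eq
    ... | inj₁ (refl , _) = ⊥-elim (clean-≢ d cl)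
    ... | inj₂ eq′ = inj₁ (bind-just ev eq′ , ran⊆support {s} (appF⇒∈ran eq′))
    step X X w _ _ (inj₂ (inj₁ ())) _
    step X (gl g) w _ gen (inj₂ (inj₁ t)) eq =
      ⊥-elim (tainted-∉dom (λ ()) (λ i → gen (there i)) t (appF⇒∈dom {s′} eq))
    step Xinv d w _ _ (inj₁ (ev , _)) eq with appB-∷⁻¹ {n} {m} {s} eq
    ... | inj₁ (_ , refl) = inj₂ (inj₁ refl)
    ... | inj₂ eq′ = inj₁ (bind-just ev eq′ , dom⊆support {s} (appB⇒∈dom eq′))
    step Xinv d w _ gen (inj₂ (inj₁ t)) eq =
      ⊥-elim (tainted-fresh (λ i → gen (there i)) t (∷-ran⊆∷-support {s} (appB⇒∈ran {s′} eq)))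
    step (gl g) d w adj gen (inj₁ (ev , cl)) eq =
      inj₁ (bind-just ev eq , λ b≡n → clean-act d (gen (here refl)) adj cl (trans (just-injective eq) b≡n))
    step (gl g) X w _ _ (inj₂ (inj₁ ())) _
    step (gl g) Xinv w _ _ (inj₂ (inj₁ refl)) eq = inj₂ (inj₁ (sym (just-injective eq)))

    trace : ∀ {c w a b} → Reduced (c ∷ w) → GenericWord (c ∷ w) → eval G (c ∷ w) s′ a ≡ just b → Trace c w a b
    trace [X] _ eq with appF-∷⁻¹ {n} {m} {s} eq
    ... | inj₁ (n≡a , _) = inj₂ (inj₂ (sym n≡a))
    ... | inj₂ eq′ = inj₁ (eq′ , ran⊆support {s} (appF⇒∈ran eq′))
    trace (cons {c} {d} {w} adj _ r) gen eq with bind-just⁻¹ {eval G (d ∷ w) s′ _} eq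
    ... | _ , e , f = step c d w adj gen (trace r (λ i → gen (there i)) e) f

    no-new-preimage : ∀ {w z} → Reduced w → ¬ HeadIsXinv w → GenericWord w → eval G w s′ z ≡ just n → ⊥
    no-new-preimage {X ∷ w} {z} _ _ _ eq with bind-just⁻¹ {eval G w s′ z} eq
    ... | _ , _ , f = n-fresh (∷-ran⊆∷-support {s} (appF⇒∈ran {s′} f))
    no-new-preimage {Xinv ∷ _} _ ¬xinv _ _ = ¬xinv tt
    no-new-preimage {gl g ∷ X ∷ w} {z} _ _ gen eq with bind-just⁻¹ {eval G (X ∷ w) s′ z} eq
    ... | _ , e , f with bind-just⁻¹ {eval G w s′ z} e
    ...   | _ , _ , f′ = act≢-on (gen (here refl)) (∷-ran⊆∷-support {s} (appF⇒∈ran {s′} f′)) (just-injective f)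
    no-new-preimage {gl g ∷ Xinv ∷ w} {z} _ _ gen eq with bind-just⁻¹ {eval G (Xinv ∷ w) s′ z} eq
    ... | _ , e , f with bind-just⁻¹ {eval G w s′ z} e
    ...   | _ , _ , f′ with appB⇒∈dom {s′} f′
    ...     | here refl = moved (gen (here refl)) (just-injective f)
    ...     | there y∈dom = act≢-on (gen (here refl)) (there (dom⊆support {s} y∈dom)) (just-injective f)
    no-new-preimage {gl g ∷ gl h ∷ w} (cons () _ _)

    inner : ∀ {w} → Reduced w → ¬ HeadIsXinv w → GenericWord w → InnerEdgesAgree (eval G w s) (eval G w s′)
    inner {[]} ()
    inner {_ ∷ _} r ¬xinv gen eq (_ , eq′) (_ , eq″) with trace r gen eq
    ... | inj₁ (ev , _) = ev
    ... | inj₂ (inj₁ t) = ⊥-elim (tainted-∉dom ¬xinv gen t (reduced⇒∈dom r eq′))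
    ... | inj₂ (inj₂ refl) = ⊥-elim (no-new-preimage r ¬xinv gen eq″)

  extension-refines : ∀ {r s E n m} → InZDagger G r (s , E) → n ∉ dom s → m ∉ ran s →
    (P : Letter G → Set) → (∀ {w} → w ∈ E → ∀ {c} → c ∈ w → P c) →
    (∀ {w} → Nice G w → (∀ {c} → c ∈ w → P c) → InnerEdgesAgree (eval G w s) (eval G w ((n , m) ∷ s))) →
    _≤Z_ G ((n , m) ∷ s , E) (s , E) × InZDagger G r ((n , m) ∷ s , E)
  extension-refines {r} {s} {E} {n} {m} ((pinj , niceE) , cyclic , powers) n∉dom m∉ran P P-E inner-agree =
    (there , id , fixEq) , (pinj′ , niceE) , cyclic , powers′
    where
    pinj′ : IsPInj ((n , m) ∷ s)
    pinj′ = isPInj-∷ pinj n∉dom m∉ran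

    endExtension : ∀ {w} → Nice G w → (∀ {c} → c ∈ w → P c) → EndExtension (eval G w s) (eval G w ((n , m) ∷ s))
    endExtension {w} nice P-w = record
      { extends = eval-extends n∉dom m∉ran w
      ; injective = eval-injective pinj′ w
      ; inner = inner-agree nice P-w
      }

    fixEq : ∀ {w} → w ∈ E → FixEq G w ((n , m) ∷ s) s
    fixEq w∈E _ = fixedPoint⁻ ext , EndExtension.extends ext
      where ext = endExtension (All.lookup niceE w∈E) (P-E w∈E)

    powers′ : PowerCond G r ((n , m) ∷ s) E
    powers′ w∈E v k indec w≡vᵏ =
      proj₁ (powers w∈E v k indec w≡vᵏ) ,
      λ j q q-prime q≤k → codes⁺ (endExtension (proj₁ indec) P-v) (proj₂ (powers w∈E v k indec w≡vᵏ) j q q-prime q≤k)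
      where
      P-v : ∀ {c} → c ∈ v → P c
      P-v = P-E w∈E ∘ letter-of-root k (All.lookup niceE w∈E) w≡vᵏ

corollary4p20 : (G : CofinitaryGroup) (r : ℕ → Bool) (s : PInj) (E : List (Word G)) →
    InZDagger G r (s , E) →
    ((n : ℕ) → n ∉ dom s → Σ ℕ λ M → (m : ℕ) → M ≤ m →
       _≤Z_ G ((n , m) ∷ s , E) (s , E) × InZDagger G r ((n , m) ∷ s , E))
    ×
    ((m : ℕ) → m ∉ ran s → Σ ℕ λ N → (n : ℕ) → N ≤ n →
       _≤Z_ G ((n , m) ∷ s , E) (s , E) × InZDagger G r ((n , m) ∷ s , E))
corollary4p20 G r s E zd = fresh-image , fresh-preimage
  where
  open Words G
  niceE = proj₂ (proj₁ zd)

  fresh-image : (n : ℕ) → n ∉ dom s → Eventually λ m →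
    _≤Z_ G ((n , m) ∷ s , E) (s , E) × InZDagger G r ((n , m) ∷ s , E)
  fresh-image n n∉dom =
    eventually-map
      (λ {m} (m-fresh , generic) →
        extension-refines zd n∉dom (m-fresh ∘ there ∘ ran⊆support {s}) (GenericLetter (n ∷ support s) m) generic
          (λ nice → FreshImage.inner s n m m-fresh (proj₁ (nice⇒reduced nice))))
      (eventually-× (eventually-∉ (n ∷ support s)) (eventually-genericLetters (n ∷ support s) E niceE))

  fresh-preimage : (m : ℕ) → m ∉ ran s → Eventually λ n →
    _≤Z_ G ((n , m) ∷ s , E) (s , E) × InZDagger G r ((n , m) ∷ s , E)
  fresh-preimage m m∉ran =
    eventually-map
      (λ {n} (n-fresh , generic) →
        extension-refines zd (n-fresh ∘ there ∘ dom⊆support {s}) m∉ran (GenericLetter (m ∷ support s) n) generic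
          (λ nice → FreshPreimage.inner s n m n-fresh (proj₁ (nice⇒reduced nice)) (proj₂ (nice⇒reduced nice))))
      (eventually-× (eventually-∉ (m ∷ support s)) (eventually-genericLetters (m ∷ support s) E niceE))
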